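{- Let $M\in\mathbb{N}$ and let $\psi:\mathbb{Z}_M\to\mathbb{Z}_M$ be a divisor isometry. If $A\oplus B=\mathbb{Z}_M$ is a tiling, then $\psi(A)\oplus B=\mathbb{Z}_M$ is also a tiling.
   Context: $\psi$ is a divisor isometry if $\gcd(\psi(x)-\psi(x'),M)=\gcd(x-x',M)$ for all $x,x'\in\mathbb{Z}_M$. $A\oplus B=\mathbb{Z}_M$ (for sets $A,B\subset\mathbb{Z}_M$) means every element of $\mathbb{Z}_M$ is uniquely $a+b$ with $a\in A$, $b\in B$. -}

module Defs where

open import Data.Nat using (ℕ; _+_; _∸_; NonZero)
open import Data.Nat.DivMod using (_%_)
open import Data.Nat.GCD using (gcd)
open import Data.Fin using (Fin; toℕ; fromℕ<)
open import Data.Nat.DivMod using (m%n<n)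
open import Data.Product using (_×_; ∃; ∃!; _,_)
open import Relation.Binary.PropositionalEquality using (_≡_)
open import Level using (0ℓ)

-- ℤ_M is represented by Fin M = {0,…,M-1}, for M ≥ 1.

_+M_ : {M : ℕ} .{{_ : NonZero M}} → Fin M → Fin M → Fin M
_+M_ {M} a b = fromℕ< (m%n<n (toℕ a + toℕ b) M)

diffM : {M : ℕ} .{{_ : NonZero M}} → Fin M → Fin M → ℕ
diffM {M} x x' = (toℕ x + (M ∸ toℕ x')) % M

DivisorIsometry : (M : ℕ) .{{_ : NonZero M}} → (Fin M → Fin M) → Set
DivisorIsometry M ψ =
  ∀ (x x' : Fin M) → gcd (diffM (ψ x) (ψ x')) M ≡ gcd (diffM x x') M

SubsetM : ℕ → Set₁
SubsetM M = Fin M → Set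

image : {M : ℕ} → (Fin M → Fin M) → SubsetM M → SubsetM M
image ψ A y = ∃ λ a → A a × ψ a ≡ y

Tiling : (M : ℕ) .{{_ : NonZero M}} → SubsetM M → SubsetM M → Set
Tiling M A B = ∀ (x : Fin M) →
  ∃! _≡_ (λ (p : Fin M × Fin M) → let (a , b) = p in A a × B b × (a +M b) ≡ x)

{-# OPTIONS --safe #-}
module Submission where

-- Identify a subset X ⊆ ℤ_M with its indicator 𝟙X in the group semiring ℕ[ℤ_M] (functions
-- ℤ_M → ℕ under convolution ⋆); then A ⊕ B = ℤ_M says exactly that 𝟙A ⋆ 𝟙B is constantly 1.
--
-- Tijdeman: for r coprime to M, also rA ⊕ B = ℤ_M.  It suffices to take r = p prime.  By the
-- Frobenius congruence f ^ p ≡ dilate p f (mod p), every value of dilate p 𝟙A ⋆ 𝟙B is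
-- ≡ (𝟙A ^ p ⋆ 𝟙B)(s) = |A| ^ (p - 1) (mod p), which is nonzero as p ∤ |A|.  So all values are
-- at least 1, and as they add up to |A| |B| = M, they all equal 1.
--
-- Now let ψ(a₁) + b₁ = ψ(a₂) + b₂ with aᵢ ∈ A, bᵢ ∈ B.  Then a₁ - a₂ and ψ(a₁) - ψ(a₂) =
-- b₂ - b₁ have the same gcd with M, so b₂ - b₁ = r (a₁ - a₂) for a unit r, i.e.
-- r a₁ + b₁ = r a₂ + b₂, and the tiling rA ⊕ B forces a₁ = a₂.  Hence the |A| |B| = M sums
-- ψ(a) + b are pairwise distinct, so they cover ℤ_M exactly once.

open import Defs
open import Algebra.Bundles using (CommutativeSemiring)
open import Algebra.Structures.Biased using (IsCommutativeSemiringˡ)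
open import Data.Fin using (Fin; zero; suc; toℕ; fromℕ; fromℕ<; inject₁)
open import Data.Fin.Permutation using (permutation)
open import Data.Fin.Properties
  using (toℕ-fromℕ; toℕ-inject₁; toℕ-fromℕ<; toℕ-injective; toℕ<n; _≟_; suc-injective; 0≢1+n)
open import Data.List.Base using (_∷_)
open import Data.List.Relation.Unary.All using (All; []; _∷_)
open import Data.Nat
  using (ℕ; zero; suc; _+_; _*_; _^_; _∸_; _≤_; _<_; _!; z≤n; s≤s;
         NonZero; ≢-nonZero; ≢-nonZero⁻¹; >-nonZero; nonTrivial⇒≢1)
open import Data.Nat.Combinatorics using (_C_; k![n∸k]!∣n!; nCn≡1)
open import Data.Nat.Combinatorics.Specification using (nCk≡n!/k![n-k]!)
open import Data.Nat.Coprimality as Coprimality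
  using (Coprime; 0-coprimeTo-m⇒m≡1; 1-coprimeTo; coprime-Bézout; coprime-divisor; coprime-/gcd)
open import Data.Nat.Divisibility
  using (_∣_; _∣?_; _∣0; ∣-trans; ∣1⇒≡1; ∣⇒≤; m∣m*n; ∣m⇒∣m*n; ∣n⇒∣m*n; ∣m∣n⇒∣m+n; ∣m+n∣m⇒∣n;
         %-presˡ-∣; m%n≡0⇒n∣m)
open import Data.Nat.DivMod
  using (_%_; _/_; m%n<n; m%n%n≡m%n; %-distribˡ-+; %-distribˡ-*; [m+n]%n≡m%n; [m+kn]%n≡m%n;
         m<n⇒m%n≡m; %-remove-+ʳ; %-congʳ; m%n*o≡m*o%[n*o]; m/n*n≡m; m≥n⇒m/n>0)
open import Data.Nat.GCD using (gcd; gcd[m,n]∣m; gcd[m,n]∣n; gcd[m,n]≢0; module Bézout)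
open import Data.Nat.ListAction using (product)
open import Data.Nat.Primality using (Prime; prime⇒irreducible; prime⇒nonZero; prime⇒nonTrivial; euclidsLemma)
open import Data.Nat.Primality.Factorisation using (factorise)
open import Data.Nat.Properties
  using (+-*-semiring; +-assoc; +-comm; +-identityʳ; *-assoc; *-comm; *-identityˡ; *-identityʳ;
         *-distribˡ-+; *-distribʳ-+; +-cancelˡ-≡; +-cancelʳ-≤; +-mono-≤; +-monoʳ-≤; m*n≢0;
         m+[n∸m]≡n; m∸n+n≡m; n∸n≡0; n<1+n; n<1⇒n≡0; <-trans; <⇒≤; <⇒≱; ∸-monoʳ-<;
         ≤-antisym; ≤-reflexive; _!*_!≢0; module ≤-Reasoning)
open import Data.Nat.Tactic.RingSolver using (solve-∀)
open import Data.Product using (_×_; _,_; ∃; proj₁; proj₂)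
open import Data.Sum using (inj₁; inj₂)
open import Function using (_∘_; const)
open import Level using (0ℓ)
open import Relation.Binary.Bundles using (Setoid)
import Relation.Binary.Construct.On as On
open import Relation.Binary.PropositionalEquality hiding ([_])
open import Relation.Binary.Structures using (IsEquivalence)
open import Relation.Nullary using (Dec; yes; no; ¬_; contradiction; _×-dec_)
open import Algebra.Properties.Semiring.Sum +-*-semiring
  using (sum; sum-cong-≗; sum-init-last; sum-replicate-zero; sum-permute; ∑-comm; ∑-distrib-+;
         *-distribˡ-sum; *-distribʳ-sum)

infix 4 _≡_mod_

_≡_mod_ : ℕ → ℕ → (n : ℕ) .{{_ : NonZero n}} → Set
x ≡ y mod n = x % n ≡ y % n

mod-setoid : (n : ℕ) .{{_ : NonZero n}} → Setoid 0ℓ 0ℓ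
mod-setoid n = On.setoid (setoid ℕ) (_% n)

module ≡-mod-Reasoning (n : ℕ) .{{_ : NonZero n}} where
  open import Relation.Binary.Reasoning.Setoid (mod-setoid n) public

module _ {n : ℕ} .{{_ : NonZero n}} where

  %-≡-mod : ∀ x → x % n ≡ x mod n
  %-≡-mod x = m%n%n≡m%n x n

  +-cong-mod : ∀ {x x′ y y′} → x ≡ x′ mod n → y ≡ y′ mod n → x + y ≡ x′ + y′ mod n
  +-cong-mod {x} {x′} {y} {y′} x≡x′ y≡y′ = begin
    (x + y) % n                ≡⟨ %-distribˡ-+ x y n ⟩
    (x % n + y % n) % n        ≡⟨ cong₂ (λ u v → (u + v) % n) x≡x′ y≡y′ ⟩
    (x′ % n + y′ % n) % n      ≡⟨ %-distribˡ-+ x′ y′ n ⟨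
    (x′ + y′) % n              ∎
    where open ≡-Reasoning

  *-cong-mod : ∀ {x x′ y y′} → x ≡ x′ mod n → y ≡ y′ mod n → x * y ≡ x′ * y′ mod n
  *-cong-mod {x} {x′} {y} {y′} x≡x′ y≡y′ = begin
    (x * y) % n                ≡⟨ %-distribˡ-* x y n ⟩
    (x % n * (y % n)) % n      ≡⟨ cong₂ (λ u v → (u * v) % n) x≡x′ y≡y′ ⟩
    (x′ % n * (y′ % n)) % n    ≡⟨ %-distribˡ-* x′ y′ n ⟨
    (x′ * y′) % n              ∎
    where open ≡-Reasoning

  +-cancelʳ-mod : ∀ {x y} z → x + z ≡ y + z mod n → x ≡ y mod n
  +-cancelʳ-mod {x} {y} z x+z≡y+z = begin
    x                      ≈⟨ +-complement x ⟨
    x + z + (n ∸ z % n)    ≈⟨ +-cong-mod {x = x + z} {y + z} x+z≡y+z refl ⟩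
    y + z + (n ∸ z % n)    ≈⟨ +-complement y ⟩
    y                      ∎
    where
    open ≡-mod-Reasoning n
    +-complement : ∀ u → u + z + (n ∸ z % n) ≡ u mod n
    +-complement u = begin
      u + z + (n ∸ z % n)        ≈⟨ +-cong-mod (+-cong-mod {x = u} refl (%-≡-mod z)) refl ⟨
      u + z % n + (n ∸ z % n)    ≡⟨ +-assoc u (z % n) _ ⟩
      u + (z % n + (n ∸ z % n))  ≡⟨ cong (u +_) (m+[n∸m]≡n (<⇒≤ (m%n<n z n))) ⟩
      u + n                      ≈⟨ [m+n]%n≡m%n u n ⟩
      u                          ∎

≡-mod∧∤⇒≥1 : ∀ {x c n} .{{_ : NonZero n}} → x ≡ c mod n → ¬ n ∣ c → 1 ≤ x
≡-mod∧∤⇒≥1 {zero}  {c} {suc n} 0≡c n∤c = contradiction (m%n≡0⇒n∣m c (suc n) (sym 0≡c)) n∤c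
≡-mod∧∤⇒≥1 {suc x} _       _   = s≤s z≤n

*-mod-scale : ∀ {a b m} d .{{_ : NonZero m}} .{{_ : NonZero (m * d)}} →
              a ≡ b mod m → a * d ≡ b * d mod (m * d)
*-mod-scale {a} {b} {m} d a≡b = begin
  a * d % (m * d)   ≡⟨ m%n*o≡m*o%[n*o] a m d ⟨
  a % m * d         ≡⟨ cong (_* d) a≡b ⟩
  b % m * d         ≡⟨ m%n*o≡m*o%[n*o] b m d ⟩
  b * d % (m * d)   ∎
  where open ≡-Reasoning

-- Elementary number theory

prime≢1 : ∀ {p} → Prime p → p ≢ 1
prime≢1 p-prime = nonTrivial⇒≢1 {{prime⇒nonTrivial p-prime}}

prime∣^⇒∣ : ∀ {p x n} → Prime p → p ∣ x ^ n → p ∣ x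
prime∣^⇒∣ {n = zero}      p-prime p∣1 = contradiction (∣1⇒≡1 p∣1) (prime≢1 p-prime)
prime∣^⇒∣ {x = x} {suc n} p-prime p∣x^1+n with euclidsLemma x (x ^ n) p-prime p∣x^1+n
... | inj₁ p∣x   = p∣x
... | inj₂ p∣x^n = prime∣^⇒∣ {n = n} p-prime p∣x^n

prime∤! : ∀ {p j} → Prime p → j < p → ¬ p ∣ j !
prime∤! {j = zero}  p-prime j<p p∣1 = prime≢1 p-prime (∣1⇒≡1 p∣1)
prime∤! {j = suc j} p-prime j<p p∣j! with euclidsLemma (suc j) (j !) p-prime p∣j!
... | inj₁ p∣1+j = <⇒≱ j<p (∣⇒≤ p∣1+j)
... | inj₂ p∣j!  = prime∤! p-prime (<-trans (n<1+n j) j<p) p∣j!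

n∣n! : ∀ n .{{_ : NonZero n}} → n ∣ n !
n∣n! (suc n) = m∣m*n (n !)

nCk*[k!*[n∸k]!]≡n! : ∀ {n k} → k ≤ n → (n C k) * (k ! * (n ∸ k) !) ≡ n !
nCk*[k!*[n∸k]!]≡n! {n} {k} k≤n =
  trans (cong (_* (k ! * (n ∸ k) !)) (nCk≡n!/k![n-k]! k≤n)) (m/n*n≡m {{k !* (n ∸ k) !≢0}} (k![n∸k]!∣n! k≤n))

prime∣pCk : ∀ {p k} → Prime p → 0 < k → k < p → p ∣ p C k
prime∣pCk {p} {k} p-prime 0<k k<p
  with euclidsLemma (p C k) (k ! * (p ∸ k) !) p-prime
         (subst (p ∣_) (sym (nCk*[k!*[n∸k]!]≡n! (<⇒≤ k<p))) (n∣n! p {{prime⇒nonZero p-prime}}))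
... | inj₁ p∣C = p∣C
... | inj₂ p∣k!*[p∸k]! with euclidsLemma (k !) ((p ∸ k) !) p-prime p∣k!*[p∸k]!
...   | inj₁ p∣k!     = contradiction p∣k! (prime∤! p-prime k<p)
...   | inj₂ p∣[p∸k]! = contradiction p∣[p∸k]! (prime∤! p-prime (∸-monoʳ-< 0<k (<⇒≤ k<p)))

∣-sum : ∀ {d n} (f : Fin n → ℕ) → (∀ i → d ∣ f i) → d ∣ sum f
∣-sum {d} {zero}  f d∣f = d ∣0
∣-sum {d} {suc n} f d∣f = ∣m∣n⇒∣m+n (d∣f zero) (∣-sum (f ∘ suc) (d∣f ∘ suc))

∑-binomial-mod-prime : ∀ {p} .{{_ : NonZero p}} → Prime p → (X : Fin (suc p) → ℕ) →
                       sum (λ k → (p C toℕ k) * X k) ≡ X zero + X (fromℕ p) mod p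
∑-binomial-mod-prime {suc q} p-prime X = begin
  t zero + sum (t ∘ suc)                         ≡⟨ cong (t zero +_) (sum-init-last (t ∘ suc)) ⟩
  t zero + (sum (t ∘ suc ∘ inject₁) + t last)    ≡⟨ cong (t zero +_) (+-comm _ (t last)) ⟩
  t zero + (t last + sum (t ∘ suc ∘ inject₁))    ≡⟨ +-assoc (t zero) (t last) _ ⟨
  t zero + t last + sum (t ∘ suc ∘ inject₁)      ≈⟨ %-remove-+ʳ (t zero + t last) (∣-sum _ p∣middle) ⟩
  t zero + t last                                ≡⟨ cong₂ _+_ (+-identityʳ (X zero)) t-last ⟩
  X zero + X last                                ∎
  where
  open ≡-mod-Reasoning (suc q)
  last = fromℕ (suc q)
  t : Fin (suc (suc q)) → ℕ
  t k = (suc q C toℕ k) * X k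
  t-last : t last ≡ X last
  t-last = trans (cong (λ k → (suc q C suc k) * X last) (toℕ-fromℕ q))
                 (trans (cong (_* X last) (nCn≡1 (suc q))) (*-identityˡ (X last)))
  p∣middle : ∀ k → suc q ∣ t (suc (inject₁ k))
  p∣middle k = ∣m⇒∣m*n _ (subst (λ j → suc q ∣ suc q C suc j) (sym (toℕ-inject₁ k))
                                (prime∣pCk p-prime (s≤s z≤n) (s≤s (toℕ<n k))))

coprime-* : ∀ {a b c} → Coprime a b → Coprime a c → Coprime a (b * c)
coprime-* a⊥b a⊥c (e∣a , e∣bc) = a⊥c (e∣a , coprime-divisor (λ (f∣e , f∣b) → a⊥b (∣-trans f∣e e∣a , f∣b)) e∣bc)

prime∤⇒coprime : ∀ {p a} → Prime p → ¬ p ∣ a → Coprime a p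
prime∤⇒coprime p-prime p∤a (e∣a , e∣p) with prime⇒irreducible p-prime e∣p
... | inj₁ e≡1  = e≡1
... | inj₂ refl = contradiction e∣a p∤a

coprime-/gcd′ : ∀ a n {d} .{{_ : NonZero d}} → gcd a n ≡ d → Coprime (a / d) (n / d)
coprime-/gcd′ a n refl = coprime-/gcd a n

*≡1-mod⇒coprime : ∀ {s x m} .{{_ : NonZero m}} → s * x ≡ 1 mod m → Coprime s m
*≡1-mod⇒coprime {s} {x} {m} s*x≡1 (e∣s , e∣m) =
  ∣1⇒≡1 (e∣1 m e∣m (subst (_ ∣_) s*x≡1 (%-presˡ-∣ (∣m⇒∣m*n x e∣s) e∣m)))
  where
  e∣1 : ∀ {e} n .{{_ : NonZero n}} → e ∣ n → e ∣ 1 % n → e ∣ 1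
  e∣1 1             e∣n _     = e∣n
  e∣1 (suc (suc n)) _   e∣1%n = e∣1%n

coprime-mod-inverse : ∀ {x m} .{{_ : NonZero m}} → Coprime x m → ∃ λ s → s * x ≡ 1 mod m
coprime-mod-inverse {x} {m} x⊥m with coprime-Bézout x⊥m
... | Bézout.+- s t 1+t*m≡s*x = s , (begin
  s * x        ≡⟨ 1+t*m≡s*x ⟨
  1 + t * m    ≈⟨ [m+kn]%n≡m%n 1 t m ⟩
  1            ∎)
  where open ≡-mod-Reasoning m
-- Here s inverts -x, so (m - 1) s inverts x.
... | Bézout.-+ s t 1+s*x≡t*m = (m ∸ 1) * s , (begin
  (m ∸ 1) * s * x                 ≈⟨ [m+n]%n≡m%n ((m ∸ 1) * s * x) m ⟨
  (m ∸ 1) * s * x + m             ≡⟨ regroup m ⟩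
  (m ∸ 1) * (1 + s * x) + 1       ≡⟨ cong (λ u → (m ∸ 1) * u + 1) 1+s*x≡t*m ⟩
  (m ∸ 1) * (t * m) + 1           ≡⟨ trans (cong (1 +_) (*-assoc (m ∸ 1) t m)) (+-comm 1 _) ⟨
  1 + (m ∸ 1) * t * m             ≈⟨ [m+kn]%n≡m%n 1 ((m ∸ 1) * t) m ⟩
  1                               ∎)
  where
  open ≡-mod-Reasoning m
  regroup : ∀ n .{{_ : NonZero n}} → (n ∸ 1) * s * x + n ≡ (n ∸ 1) * (1 + s * x) + 1
  regroup (suc n) = identity n s x
    where
    identity : ∀ n s x → n * s * x + suc n ≡ n * (1 + s * x) + 1
    identity = solve-∀

coprime-lift-primes : ∀ {u m} → Coprime u m → ∀ {ps} → All Prime ps →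
                      ∃ λ k → Coprime (u + m * k) (product ps)
coprime-lift-primes {u} {m} u⊥m [] = 0 , Coprimality.sym (1-coprimeTo (u + m * 0))
coprime-lift-primes {u} {m} u⊥m {p ∷ ps} (p-prime ∷ ps-prime) with coprime-lift-primes u⊥m ps-prime
... | k , v⊥N with p ∣? u + m * k
...   | no p∤v  = k , coprime-* (prime∤⇒coprime p-prime p∤v) v⊥N
-- Shifting k by N changes u + m k by m N, which is ≡ 0 mod N but ≢ 0 mod p.
...   | yes p∣v = k + N , coprime-* (prime∤⇒coprime p-prime p∤v′) v′⊥N
  where
  N = product ps
  v′≡v+m*N : u + m * (k + N) ≡ (u + m * k) + m * N
  v′≡v+m*N = trans (cong (u +_) (*-distribˡ-+ m k N)) (sym (+-assoc u (m * k) (m * N)))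
  v′⊥N : Coprime (u + m * (k + N)) N
  v′⊥N {e} (e∣v′ , e∣N) =
    v⊥N (∣m+n∣m⇒∣n (subst (e ∣_) (trans v′≡v+m*N (+-comm _ (m * N))) e∣v′) (∣n⇒∣m*n m e∣N) , e∣N)
  p∤v′ : ¬ p ∣ u + m * (k + N)
  p∤v′ p∣v′ with euclidsLemma m N p-prime (∣m+n∣m⇒∣n (subst (p ∣_) v′≡v+m*N p∣v′) p∣v)
  ... | inj₁ p∣m = prime≢1 p-prime (u⊥m (∣m+n∣m⇒∣n (subst (p ∣_) (+-comm u (m * k)) p∣v) (∣m⇒∣m*n k p∣m) , p∣m))
  ... | inj₂ p∣N = prime≢1 p-prime (v⊥N (p∣v , p∣N))

coprime-lift : ∀ {u m} M .{{_ : NonZero M}} → Coprime u m → ∃ λ k → Coprime (u + m * k) M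
coprime-lift {u} {m} M u⊥m with factorise M
... | record { factors = ps ; isFactorisation = M≡∏ps ; factorsPrime = ps-prime } =
  let k , v⊥∏ps = coprime-lift-primes u⊥m ps-prime in k , subst (Coprime (u + m * k)) (sym M≡∏ps) v⊥∏ps

coprime-multiplier : ∀ {x y m} M .{{_ : NonZero m}} .{{_ : NonZero M}} → Coprime x m → Coprime y m →
                     ∃ λ r → Coprime r M × r * x ≡ y mod m
coprime-multiplier {x} {y} {m} M x⊥m y⊥m = r , r⊥M , (begin
  (s * y + m * k) * x      ≈⟨ *-cong-mod {m} (%-remove-+ʳ (s * y) (m∣m*n k)) refl ⟩
  s * y * x                ≡⟨ rearrange s y x ⟩
  y * (s * x)              ≈⟨ *-cong-mod {m} {y} refl s*x≡1 ⟩
  y * 1                    ≡⟨ *-identityʳ y ⟩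
  y                        ∎)
  where
  open ≡-mod-Reasoning m
  s = proj₁ (coprime-mod-inverse x⊥m)
  s*x≡1 = proj₂ (coprime-mod-inverse x⊥m)
  sy⊥m : Coprime (s * y) m
  sy⊥m = Coprimality.sym (coprime-* {m} {s} {y} (Coprimality.sym (*≡1-mod⇒coprime s*x≡1)) (Coprimality.sym y⊥m))
  k = proj₁ (coprime-lift M sy⊥m)
  r = s * y + m * k
  r⊥M = proj₂ (coprime-lift M sy⊥m)
  rearrange : ∀ s y x → s * y * x ≡ y * (s * x)
  rearrange = solve-∀

gcd≡⇒coprime-multiplier : ∀ {M} .{{_ : NonZero M}} x y → gcd x M ≡ gcd y M →
                          ∃ λ r → Coprime r M × r * x ≡ y mod M
gcd≡⇒coprime-multiplier {M} x y gcd[x,M]≡gcd[y,M] = r , r⊥M , (begin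
  r * x % M              ≡⟨ cong (λ z → r * z % M) x≡x′*d ⟩
  r * (x′ * d) % M       ≡⟨ cong (_% M) (*-assoc r x′ d) ⟨
  r * x′ * d % M         ≡⟨ %-congʳ M≡m*d ⟩
  r * x′ * d % (m * d)   ≡⟨ *-mod-scale {r * x′} {y′} {m} d r*x′≡y′ ⟩
  y′ * d % (m * d)       ≡⟨ %-congʳ M≡m*d ⟨
  y′ * d % M             ≡⟨ cong (_% M) y≡y′*d ⟨
  y % M                  ∎)
  where
  open ≡-Reasoning
  d = gcd x M
  instance
    d≢0 : NonZero d
    d≢0 = ≢-nonZero (gcd[m,n]≢0 x M (inj₂ (≢-nonZero⁻¹ M)))
  m = M / d
  instance
    m≢0 : NonZero m
    m≢0 = >-nonZero (m≥n⇒m/n>0 (∣⇒≤ (gcd[m,n]∣n x M)))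
    m*d≢0 : NonZero (m * d)
    m*d≢0 = m*n≢0 m d
  x′ = x / d
  y′ = y / d
  x≡x′*d : x ≡ x′ * d
  x≡x′*d = sym (m/n*n≡m (gcd[m,n]∣m x M))
  y≡y′*d : y ≡ y′ * d
  y≡y′*d = sym (m/n*n≡m (subst (_∣ y) (sym gcd[x,M]≡gcd[y,M]) (gcd[m,n]∣m y M)))
  M≡m*d : M ≡ m * d
  M≡m*d = sym (m/n*n≡m (gcd[m,n]∣n x M))
  multiplier = coprime-multiplier M (coprime-/gcd x M) (coprime-/gcd′ y M (sym gcd[x,M]≡gcd[y,M]))
  r = proj₁ multiplier
  r⊥M = proj₁ (proj₂ multiplier)
  r*x′≡y′ = proj₂ (proj₂ multiplier)

-- The cyclic group ℤ_M

module _ {M : ℕ} .{{_ : NonZero M}} where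

  [_] : ℕ → Fin M
  [ x ] = fromℕ< (m%n<n x M)

  0M : Fin M
  0M = [ 0 ]

  infixl 6 _-M_
  infixr 7 _·M_

  _-M_ : Fin M → Fin M → Fin M
  a -M b = [ toℕ a + (M ∸ toℕ b) ]

  _·M_ : ℕ → Fin M → Fin M
  r ·M a = [ r * toℕ a ]

  toℕ-[] : ∀ x → toℕ [ x ] ≡ x mod M
  toℕ-[] x = trans (cong (_% M) (toℕ-fromℕ< (m%n<n x M))) (%-≡-mod x)

  ≡-mod⇒≡ : ∀ {a b : Fin M} → toℕ a ≡ toℕ b mod M → a ≡ b
  ≡-mod⇒≡ {a} {b} a≡b = toℕ-injective (begin
    toℕ a        ≡⟨ m<n⇒m%n≡m (toℕ<n a) ⟨
    toℕ a % M    ≡⟨ a≡b ⟩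
    toℕ b % M    ≡⟨ m<n⇒m%n≡m (toℕ<n b) ⟩
    toℕ b        ∎)
    where open ≡-Reasoning

  ≡-mod⇒[]≡ : ∀ {x y} → x ≡ y mod M → [ x ] ≡ [ y ]
  ≡-mod⇒[]≡ {x} {y} x≡y = ≡-mod⇒≡ (trans (toℕ-[] x) (trans x≡y (sym (toℕ-[] y))))

  toℕ-+M : ∀ a b → toℕ (a +M b) ≡ toℕ a + toℕ b mod M
  toℕ-+M a b = toℕ-[] (toℕ a + toℕ b)

  toℕ--M : ∀ a b → toℕ (a -M b) + toℕ b ≡ toℕ a mod M
  toℕ--M a b = begin
    toℕ (a -M b) + toℕ b          ≈⟨ +-cong-mod (toℕ-[] (toℕ a + (M ∸ toℕ b))) refl ⟩
    toℕ a + (M ∸ toℕ b) + toℕ b   ≡⟨ +-assoc (toℕ a) _ _ ⟩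
    toℕ a + (M ∸ toℕ b + toℕ b)   ≡⟨ cong (toℕ a +_) (m∸n+n≡m (<⇒≤ (toℕ<n b))) ⟩
    toℕ a + M                     ≈⟨ [m+n]%n≡m%n (toℕ a) M ⟩
    toℕ a                         ∎
    where open ≡-mod-Reasoning M

  toℕ-·M : ∀ r a → toℕ (r ·M a) ≡ r * toℕ a mod M
  toℕ-·M r a = toℕ-[] (r * toℕ a)

  toℕ--M≡diffM : ∀ a b → toℕ (a -M b) ≡ diffM a b
  toℕ--M≡diffM a b = toℕ-fromℕ< (m%n<n (toℕ a + (M ∸ toℕ b)) M)

  +M-comm : ∀ a b → a +M b ≡ b +M a
  +M-comm a b = cong [_] (+-comm (toℕ a) (toℕ b))

  +M-assoc : ∀ a b c → (a +M b) +M c ≡ a +M (b +M c)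
  +M-assoc a b c = ≡-mod⇒≡ (begin
    toℕ ((a +M b) +M c)        ≈⟨ toℕ-+M (a +M b) c ⟩
    toℕ (a +M b) + toℕ c       ≈⟨ +-cong-mod (toℕ-+M a b) refl ⟩
    toℕ a + toℕ b + toℕ c      ≡⟨ +-assoc (toℕ a) _ _ ⟩
    toℕ a + (toℕ b + toℕ c)    ≈⟨ +-cong-mod {x = toℕ a} refl (toℕ-+M b c) ⟨
    toℕ a + toℕ (b +M c)       ≈⟨ toℕ-+M a (b +M c) ⟨
    toℕ (a +M (b +M c))        ∎)
    where open ≡-mod-Reasoning M

  +M-identityʳ : ∀ a → a +M 0M ≡ a
  +M-identityʳ a = ≡-mod⇒≡ (begin
    toℕ (a +M 0M)        ≈⟨ toℕ-+M a 0M ⟩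
    toℕ a + toℕ 0M       ≈⟨ +-cong-mod {x = toℕ a} refl (toℕ-[] 0) ⟩
    toℕ a + 0            ≡⟨ +-identityʳ (toℕ a) ⟩
    toℕ a                ∎)
    where open ≡-mod-Reasoning M

  -M-+M : ∀ a b → (a -M b) +M b ≡ a
  -M-+M a b = ≡-mod⇒≡ (trans (toℕ-+M (a -M b) b) (toℕ--M a b))

  +M-cancelʳ : ∀ {a a′} b → a +M b ≡ a′ +M b → a ≡ a′
  +M-cancelʳ {a} {a′} b a+b≡a′+b = ≡-mod⇒≡ (+-cancelʳ-mod (toℕ b) (begin
    toℕ a + toℕ b        ≈⟨ toℕ-+M a b ⟨
    toℕ (a +M b)         ≡⟨ cong toℕ a+b≡a′+b ⟩
    toℕ (a′ +M b)        ≈⟨ toℕ-+M a′ b ⟩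
    toℕ a′ + toℕ b       ∎))
    where open ≡-mod-Reasoning M

  -M-unique : ∀ {a b c} → c +M b ≡ a → a -M b ≡ c
  -M-unique {a} {b} {c} c+b≡a = +M-cancelʳ b (trans (-M-+M a b) (sym c+b≡a))

  +M--M : ∀ a b → (a +M b) -M b ≡ a
  +M--M a b = -M-unique refl

  +M-difference : ∀ a b → a +M (b -M a) ≡ b
  +M-difference a b = trans (+M-comm a (b -M a)) (-M-+M b a)

  -M-involutive : ∀ s a → s -M (s -M a) ≡ a
  -M-involutive s a = -M-unique (+M-difference a s)

  -M-+M-distrib : ∀ s a b → s -M (a +M b) ≡ (s -M b) -M a
  -M-+M-distrib s a b = -M-unique (begin
    ((s -M b) -M a) +M (a +M b)   ≡⟨ +M-assoc _ a b ⟨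
    (((s -M b) -M a) +M a) +M b   ≡⟨ cong (_+M b) (-M-+M (s -M b) a) ⟩
    (s -M b) +M b                 ≡⟨ -M-+M s b ⟩
    s                             ∎)
    where open ≡-Reasoning

  -M-identityʳ : ∀ a → a -M 0M ≡ a
  -M-identityʳ a = -M-unique (+M-identityʳ a)

  ·M-suc : ∀ r a → suc r ·M a ≡ a +M (r ·M a)
  ·M-suc r a = ≡-mod⇒≡ (begin
    toℕ (suc r ·M a)          ≈⟨ toℕ-·M (suc r) a ⟩
    toℕ a + r * toℕ a         ≈⟨ +-cong-mod {x = toℕ a} refl (toℕ-·M r a) ⟨
    toℕ a + toℕ (r ·M a)      ≈⟨ toℕ-+M a (r ·M a) ⟨
    toℕ (a +M (r ·M a))       ∎)
    where open ≡-mod-Reasoning M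

  ·M-assoc : ∀ p r a → p ·M r ·M a ≡ (p * r) ·M a
  ·M-assoc p r a = ≡-mod⇒[]≡ (begin
    p * toℕ (r ·M a)     ≈⟨ *-cong-mod {x = p} refl (toℕ-·M r a) ⟩
    p * (r * toℕ a)      ≡⟨ *-assoc p r (toℕ a) ⟨
    p * r * toℕ a        ∎)
    where open ≡-mod-Reasoning M

  ·M-identityˡ : ∀ a → 1 ·M a ≡ a
  ·M-identityˡ a = ≡-mod⇒≡ (trans (toℕ-·M 1 a) (cong (_% M) (*-identityˡ (toℕ a))))

  -M-swap : ∀ {c₁ c₂ b₁ b₂} → c₁ +M b₁ ≡ c₂ +M b₂ → c₁ -M c₂ ≡ b₂ -M b₁
  -M-swap {c₁} {c₂} {b₁} {b₂} c₁+b₁≡c₂+b₂ = -M-unique (+M-cancelʳ b₁ (begin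
    ((b₂ -M b₁) +M c₂) +M b₁    ≡⟨ +M-assoc (b₂ -M b₁) c₂ b₁ ⟩
    (b₂ -M b₁) +M (c₂ +M b₁)    ≡⟨ cong ((b₂ -M b₁) +M_) (+M-comm c₂ b₁) ⟩
    (b₂ -M b₁) +M (b₁ +M c₂)    ≡⟨ +M-assoc (b₂ -M b₁) b₁ c₂ ⟨
    ((b₂ -M b₁) +M b₁) +M c₂    ≡⟨ cong (_+M c₂) (-M-+M b₂ b₁) ⟩
    b₂ +M c₂                    ≡⟨ +M-comm b₂ c₂ ⟩
    c₂ +M b₂                    ≡⟨ c₁+b₁≡c₂+b₂ ⟨
    c₁ +M b₁                    ∎))
    where open ≡-Reasoning

  ·M-transfer : ∀ r {a₁ a₂ b₁ b₂} → r * toℕ (a₁ -M a₂) ≡ toℕ (b₂ -M b₁) mod M →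
                (r ·M a₁) +M b₁ ≡ (r ·M a₂) +M b₂
  ·M-transfer r {a₁} {a₂} {b₁} {b₂} r*Δa≡Δb = ≡-mod⇒≡ (begin
    toℕ ((r ·M a₁) +M b₁)                       ≈⟨ toℕ-+M (r ·M a₁) b₁ ⟩
    toℕ (r ·M a₁) + β₁                          ≈⟨ +-cong-mod (toℕ-·M r a₁) refl ⟩
    r * α₁ + β₁                                 ≈⟨ +-cong-mod (*-cong-mod {x = r} refl (toℕ--M a₁ a₂)) refl ⟨
    r * (toℕ (a₁ -M a₂) + α₂) + β₁              ≡⟨ rearrange r (toℕ (a₁ -M a₂)) α₂ β₁ ⟩
    r * toℕ (a₁ -M a₂) + β₁ + r * α₂            ≈⟨ +-cong-mod (+-cong-mod r*Δa≡Δb refl) refl ⟩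
    toℕ (b₂ -M b₁) + β₁ + r * α₂                ≈⟨ +-cong-mod (toℕ--M b₂ b₁) refl ⟩
    β₂ + r * α₂                                 ≡⟨ +-comm β₂ (r * α₂) ⟩
    r * α₂ + β₂                                 ≈⟨ +-cong-mod (toℕ-·M r a₂) refl ⟨
    toℕ (r ·M a₂) + β₂                          ≈⟨ toℕ-+M (r ·M a₂) b₂ ⟨
    toℕ ((r ·M a₂) +M b₂)                       ∎)
    where
    open ≡-mod-Reasoning M
    α₁ = toℕ a₁
    α₂ = toℕ a₂
    β₁ = toℕ b₁
    β₂ = toℕ b₂
    rearrange : ∀ r x α β → r * (x + α) + β ≡ r * x + β + r * α
    rearrange = solve-∀

δ : ∀ {n} → Fin n → Fin n → ℕ
δ zero    zero    = 1
δ zero    (suc _) = 0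
δ (suc _) zero    = 0
δ (suc a) (suc b) = δ a b

δ-diag : ∀ {n} (a : Fin n) → δ a a ≡ 1
δ-diag zero    = refl
δ-diag (suc a) = δ-diag a

δ-≢ : ∀ {n} {a b : Fin n} → a ≢ b → δ a b ≡ 0
δ-≢ {a = zero}  {zero}  a≢b = contradiction refl a≢b
δ-≢ {a = zero}  {suc b} a≢b = refl
δ-≢ {a = suc a} {zero}  a≢b = refl
δ-≢ {a = suc a} {suc b} a≢b = δ-≢ (a≢b ∘ cong suc)

δ-cong-⇔ : ∀ {n} {a b c d : Fin n} → (a ≡ b → c ≡ d) → (c ≡ d → a ≡ b) → δ a b ≡ δ c d
δ-cong-⇔ {a = a} {b} {c} {d} to from with a ≟ b
... | yes refl = trans (δ-diag a) (sym (subst (λ x → δ c x ≡ 1) (to refl) (δ-diag c)))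
... | no a≢b   = trans (δ-≢ a≢b) (sym (δ-≢ (a≢b ∘ from)))

δ-sym : ∀ {n} (a b : Fin n) → δ a b ≡ δ b a
δ-sym a b = δ-cong-⇔ {a = a} {b} sym sym

∑-δ-* : ∀ {n} (a : Fin n) (f : Fin n → ℕ) → sum (λ i → δ a i * f i) ≡ f a
∑-δ-* {suc n} zero f = begin
  1 * f zero + sum {n} (λ i → 0)  ≡⟨ cong₂ _+_ (*-identityˡ (f zero)) (sum-replicate-zero n) ⟩
  f zero + 0                       ≡⟨ +-identityʳ (f zero) ⟩
  f zero                           ∎
  where open ≡-Reasoning
∑-δ-* {suc n} (suc a) f = ∑-δ-* a (f ∘ suc)

∑-δ : ∀ {n} (a : Fin n) → sum (δ a) ≡ 1
∑-δ a = trans (sum-cong-≗ (λ i → sym (*-identityʳ (δ a i)))) (∑-δ-* a (const 1))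

sum-bijection : ∀ {n} (π π⁻¹ : Fin n → Fin n) → (∀ x → π (π⁻¹ x) ≡ x) → (∀ x → π⁻¹ (π x) ≡ x) →
                ∀ f → sum (f ∘ π) ≡ sum f
sum-bijection π π⁻¹ ππ⁻¹ π⁻¹π f = sym (sum-permute f (permutation π π⁻¹ ππ⁻¹ π⁻¹π))

∑-const-1 : ∀ n → sum {n} (const 1) ≡ n
∑-const-1 zero    = refl
∑-const-1 (suc n) = cong suc (∑-const-1 n)

sum-mono-≤ : ∀ {n} {f g : Fin n → ℕ} → (∀ i → f i ≤ g i) → sum f ≤ sum g
sum-mono-≤ {zero}  f≤g = z≤n
sum-mono-≤ {suc n} f≤g = +-mono-≤ (f≤g zero) (sum-mono-≤ (f≤g ∘ suc))

≤-pointwise∧sum≡⇒≗ : ∀ {n} {f g : Fin n → ℕ} → (∀ i → f i ≤ g i) → sum f ≡ sum g → f ≗ g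
≤-pointwise∧sum≡⇒≗ {suc n} {f} {g} f≤g ∑f≡∑g = λ
  { zero    → f₀≡g₀
  ; (suc i) → ≤-pointwise∧sum≡⇒≗ (f≤g ∘ suc) (+-cancelˡ-≡ (f zero) _ _ (trans ∑f≡∑g (cong (_+ _) (sym f₀≡g₀)))) i }
  where
  f₀≡g₀ : f zero ≡ g zero
  f₀≡g₀ = ≤-antisym (f≤g zero) (+-cancelʳ-≤ (sum (f ∘ suc)) (g zero) (f zero) (begin
    g zero + sum (f ∘ suc)   ≤⟨ +-monoʳ-≤ (g zero) (sum-mono-≤ (f≤g ∘ suc)) ⟩
    g zero + sum (g ∘ suc)   ≡⟨ ∑f≡∑g ⟨
    f zero + sum (f ∘ suc)   ∎))
    where open ≤-Reasoning

sum-cong-mod : ∀ {n m} .{{_ : NonZero m}} {f g : Fin n → ℕ} → (∀ i → f i ≡ g i mod m) → sum f ≡ sum g mod m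
sum-cong-mod {zero}  f≡g = refl
sum-cong-mod {suc n} f≡g = +-cong-mod (f≡g zero) (sum-cong-mod (f≡g ∘ suc))

sum-positive⇒∃ : ∀ {n} (f : Fin n → ℕ) → 1 ≤ sum f → ∃ λ i → 1 ≤ f i
sum-positive⇒∃ {suc n} f 1≤∑f with f zero in f₀≡
... | suc _ = zero , subst (1 ≤_) (sym f₀≡) (s≤s z≤n)
... | zero  = let i , 1≤fi = sum-positive⇒∃ (f ∘ suc) 1≤∑f in suc i , 1≤fi

sum-≤1 : ∀ {n} (f : Fin n → ℕ) → (∀ i → f i ≤ 1) → (∀ i j → 1 ≤ f i → 1 ≤ f j → i ≡ j) → sum f ≤ 1
sum-≤1 {zero}  f f≤1 unique = z≤n
sum-≤1 {suc n} f f≤1 unique with f zero in f₀≡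
... | zero  = sum-≤1 (f ∘ suc) (f≤1 ∘ suc) (λ i j 1≤fi 1≤fj → suc-injective (unique (suc i) (suc j) 1≤fi 1≤fj))
... | suc k = begin
  suc k + sum (f ∘ suc)   ≡⟨ cong (suc k +_) (trans (sum-cong-≗ rest≡0) (sum-replicate-zero n)) ⟩
  suc k + 0               ≡⟨ trans (+-identityʳ (suc k)) (sym f₀≡) ⟩
  f zero                  ≤⟨ f≤1 zero ⟩
  1                       ∎
  where
  open ≤-Reasoning
  rest≡0 : ∀ i → f (suc i) ≡ 0
  rest≡0 i with f (suc i) in fᵢ≡
  ... | zero  = refl
  ... | suc _ = contradiction (unique zero (suc i) (positive f₀≡) (positive fᵢ≡)) 0≢1+n
    where
    positive : ∀ {x y} → x ≡ suc y → 1 ≤ x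
    positive refl = s≤s z≤n

sum≡1⇒unique : ∀ {n} (f : Fin n → ℕ) → sum f ≡ 1 → ∀ {i j} → 1 ≤ f i → 1 ≤ f j → i ≡ j
sum≡1⇒unique f ∑f≡1 {i} {j} 1≤fi 1≤fj with i ≟ j
... | yes i≡j = i≡j
... | no i≢j  = contradiction (begin
  2                               ≡⟨ cong₂ _+_ (∑-δ i) (∑-δ j) ⟨
  sum (δ i) + sum (δ j)           ≡⟨ ∑-distrib-+ (δ i) (δ j) ⟨
  sum (λ x → δ i x + δ j x)       ≤⟨ sum-mono-≤ δᵢ+δⱼ≤f ⟩
  sum f                           ≡⟨ ∑f≡1 ⟩
  1                               ∎) (λ { (s≤s ()) })
  where
  open ≤-Reasoning
  δᵢ+δⱼ≤f : ∀ x → δ i x + δ j x ≤ f x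
  δᵢ+δⱼ≤f x with i ≟ x | j ≟ x
  ... | yes refl | yes refl = contradiction refl i≢j
  ... | yes refl | no j≢x   = subst₂ (λ u v → u + v ≤ f i) (sym (δ-diag i)) (sym (δ-≢ j≢x)) 1≤fi
  ... | no i≢x   | yes refl = subst₂ (λ u v → u + v ≤ f j) (sym (δ-≢ i≢x)) (sym (δ-diag j)) 1≤fj
  ... | no i≢x   | no j≢x   = subst₂ (λ u v → u + v ≤ f x) (sym (δ-≢ i≢x)) (sym (δ-≢ j≢x)) z≤n

-- The group semiring ℕ[ℤ_M]

module _ {M : ℕ} .{{_ : NonZero M}} where

  infixl 7 _⋆_
  infixl 6 _⊞_

  _⋆_ : (f g : Fin M → ℕ) → Fin M → ℕ
  (f ⋆ g) s = sum λ a → f a * g (s -M a)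

  _⊞_ : (f g : Fin M → ℕ) → Fin M → ℕ
  (f ⊞ g) s = f s + g s

  𝟘 : Fin M → ℕ
  𝟘 = const 0

  𝟙 : Fin M → ℕ
  𝟙 = δ 0M

  sum-reflect : ∀ s (f : Fin M → ℕ) → sum (λ a → f (s -M a)) ≡ sum f
  sum-reflect s = sum-bijection (s -M_) (s -M_) (-M-involutive s) (-M-involutive s)

  sum-translate : ∀ a (f : Fin M → ℕ) → sum (λ s → f (s -M a)) ≡ sum f
  sum-translate a = sum-bijection (_-M a) (_+M a) (λ s → +M--M s a) (λ s → -M-+M s a)

  sum-translate⁻ : ∀ a (f : Fin M → ℕ) → sum (λ s → f (s +M a)) ≡ sum f
  sum-translate⁻ a = sum-bijection (_+M a) (_-M a) (λ s → -M-+M s a) (λ s → +M--M s a)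

  ⋆-cong : ∀ {f f' g g'} → f ≗ f' → g ≗ g' → f ⋆ g ≗ f' ⋆ g'
  ⋆-cong f≗f' g≗g' s = sum-cong-≗ (λ a → cong₂ _*_ (f≗f' a) (g≗g' (s -M a)))

  ⋆-congˡ : ∀ f {g g'} → g ≗ g' → f ⋆ g ≗ f ⋆ g'
  ⋆-congˡ f = ⋆-cong {f = f} (λ _ → refl)

  ⋆-congʳ : ∀ g {f f'} → f ≗ f' → f ⋆ g ≗ f' ⋆ g
  ⋆-congʳ g f≗f' = ⋆-cong {g = g} f≗f' (λ _ → refl)

  ⋆-comm : ∀ f g → f ⋆ g ≗ g ⋆ f
  ⋆-comm f g s = begin
    sum (λ a → f a * g (s -M a))                 ≡⟨ sum-reflect s (λ a → f a * g (s -M a)) ⟨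
    sum (λ a → f (s -M a) * g (s -M (s -M a)))
      ≡⟨ sum-cong-≗ (λ a → cong (f (s -M a) *_) (cong g (-M-involutive s a))) ⟩
    sum (λ a → f (s -M a) * g a)                 ≡⟨ sum-cong-≗ (λ a → *-comm (f (s -M a)) (g a)) ⟩
    sum (λ a → g a * f (s -M a))                 ∎
    where open ≡-Reasoning

  ⋆-assoc : ∀ f g h → (f ⋆ g) ⋆ h ≗ f ⋆ (g ⋆ h)
  ⋆-assoc f g h s = begin
    sum (λ b → sum (λ a → f a * g (b -M a)) * h (s -M b))
      ≡⟨ sum-cong-≗ (λ b → *-distribʳ-sum (h (s -M b)) (λ a → f a * g (b -M a))) ⟩
    sum (λ b → sum (λ a → f a * g (b -M a) * h (s -M b)))
      ≡⟨ ∑-comm {M} {M} (λ b a → f a * g (b -M a) * h (s -M b)) ⟩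
    sum (λ a → sum (λ b → f a * g (b -M a) * h (s -M b)))
      ≡⟨ sum-cong-≗ (λ a → sum-cong-≗ {M} (λ b → *-assoc (f a) (g (b -M a)) (h (s -M b)))) ⟩
    sum (λ a → sum (λ b → f a * (g (b -M a) * h (s -M b))))
      ≡⟨ sum-cong-≗ (λ a → *-distribˡ-sum (f a) (λ b → g (b -M a) * h (s -M b))) ⟨
    sum (λ a → f a * sum (λ b → g (b -M a) * h (s -M b)))
      ≡⟨ sum-cong-≗ (λ a → cong (f a *_) (sum-translate⁻ a (λ b → g (b -M a) * h (s -M b)))) ⟨
    sum (λ a → f a * sum (λ c → g ((c +M a) -M a) * h (s -M (c +M a))))
      ≡⟨ sum-cong-≗ (λ a → cong (f a *_) (sum-cong-≗ (λ c →
           cong₂ _*_ (cong g (+M--M c a)) (cong h (-M-+M-distrib s c a))))) ⟩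
    sum (λ a → f a * sum (λ c → g c * h ((s -M a) -M c)))
      ∎
    where open ≡-Reasoning

  ⋆-identityˡ : ∀ f → 𝟙 ⋆ f ≗ f
  ⋆-identityˡ f s = trans (∑-δ-* 0M (λ a → f (s -M a))) (cong f (-M-identityʳ s))

  ⋆-zeroˡ : ∀ f → 𝟘 ⋆ f ≗ 𝟘
  ⋆-zeroˡ f s = sum-replicate-zero M

  ⋆-distribʳ : ∀ f g h → (g ⊞ h) ⋆ f ≗ g ⋆ f ⊞ h ⋆ f
  ⋆-distribʳ f g h s = trans (sum-cong-≗ (λ a → *-distribʳ-+ (f (s -M a)) (g a) (h a)))
                             (∑-distrib-+ (λ a → g a * f (s -M a)) (λ a → h a * f (s -M a)))

  convolution-commutativeSemiring : CommutativeSemiring 0ℓ 0ℓ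
  convolution-commutativeSemiring = record
    { Carrier = Fin M → ℕ ; _≈_ = _≗_ ; _+_ = _⊞_ ; _*_ = _⋆_ ; 0# = 𝟘 ; 1# = 𝟙
    ; isCommutativeSemiring = IsCommutativeSemiringˡ.isCommutativeSemiring record
      { +-isCommutativeMonoid = record
        { isMonoid = record
          { isSemigroup = record
            { isMagma = record { isEquivalence = ≗-isEquivalence ; ∙-cong = λ p q s → cong₂ _+_ (p s) (q s) }
            ; assoc = λ f g h s → +-assoc (f s) (g s) (h s) }
          ; identity = (λ f s → refl) , (λ f s → +-identityʳ (f s)) }
        ; comm = λ f g s → +-comm (f s) (g s) }
      ; *-isCommutativeMonoid = record
        { isMonoid = record
          { isSemigroup = record
            { isMagma = record { isEquivalence = ≗-isEquivalence ; ∙-cong = ⋆-cong }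
            ; assoc = ⋆-assoc }
          ; identity = ⋆-identityˡ , (λ f s → trans (⋆-comm f 𝟙 s) (⋆-identityˡ f s)) }
        ; comm = ⋆-comm }
      ; distribʳ = ⋆-distribʳ
      ; zeroˡ = ⋆-zeroˡ }
    }
    where
    ≗-isEquivalence : IsEquivalence (_≗_ {A = Fin M} {B = ℕ})
    ≗-isEquivalence = record { refl = λ _ → refl ; sym = λ p s → sym (p s) ; trans = λ p q s → trans (p s) (q s) }

module _ {M : ℕ} .{{_ : NonZero M}} where

  open CommutativeSemiring (convolution-commutativeSemiring {M}) using (semiring)
  open import Algebra.Properties.Semiring.Exp semiring using () renaming (_^_ to _⋆^_)

  push : (Fin M → Fin M) → (Fin M → ℕ) → Fin M → ℕ
  push φ f y = sum λ a → f a * δ (φ a) y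

  dilate : ℕ → (Fin M → ℕ) → Fin M → ℕ
  dilate r = push (r ·M_)

  ∑-push-* : ∀ φ f h → sum (λ y → push φ f y * h y) ≡ sum (λ a → f a * h (φ a))
  ∑-push-* φ f h = begin
    sum (λ y → sum (λ a → f a * δ (φ a) y) * h y)
      ≡⟨ sum-cong-≗ (λ y → *-distribʳ-sum (h y) (λ a → f a * δ (φ a) y)) ⟩
    sum (λ y → sum (λ a → f a * δ (φ a) y * h y))
      ≡⟨ ∑-comm {M} {M} (λ y a → f a * δ (φ a) y * h y) ⟩
    sum (λ a → sum (λ y → f a * δ (φ a) y * h y))
      ≡⟨ sum-cong-≗ (λ a → sum-cong-≗ {M} (λ y → *-assoc (f a) (δ (φ a) y) (h y))) ⟩
    sum (λ a → sum (λ y → f a * (δ (φ a) y * h y)))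
      ≡⟨ sum-cong-≗ (λ a → *-distribˡ-sum (f a) (λ y → δ (φ a) y * h y)) ⟨
    sum (λ a → f a * sum (λ y → δ (φ a) y * h y))
      ≡⟨ sum-cong-≗ (λ a → cong (f a *_) (∑-δ-* (φ a) h)) ⟩
    sum (λ a → f a * h (φ a))
      ∎
    where open ≡-Reasoning

  push-⋆ : ∀ φ f g s → (push φ f ⋆ g) s ≡ sum (λ a → f a * g (s -M φ a))
  push-⋆ φ f g s = ∑-push-* φ f (λ y → g (s -M y))

  push-∘ : ∀ φ χ f → push φ (push χ f) ≗ push (φ ∘ χ) f
  push-∘ φ χ f z = ∑-push-* χ f (λ y → δ (φ y) z)

  sum-push : ∀ φ f → sum (push φ f) ≡ sum f
  sum-push φ f = begin
    sum (push φ f)                    ≡⟨ sum-cong-≗ (λ y → *-identityʳ (push φ f y)) ⟨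
    sum (λ y → push φ f y * 1)        ≡⟨ ∑-push-* φ f (const 1) ⟩
    sum (λ a → f a * 1)               ≡⟨ sum-cong-≗ (λ a → *-identityʳ (f a)) ⟩
    sum f                             ∎
    where open ≡-Reasoning

  push-congˡ : ∀ {φ χ} f → φ ≗ χ → push φ f ≗ push χ f
  push-congˡ f φ≗χ y = sum-cong-≗ (λ a → cong (λ v → f a * δ v y) (φ≗χ a))

  push-congʳ : ∀ φ {f g} → f ≗ g → push φ f ≗ push φ g
  push-congʳ φ f≗g y = sum-cong-≗ (λ a → cong (λ u → u * δ (φ a) y) (f≗g a))

  push-id : ∀ f → push (λ a → a) f ≗ f
  push-id f y = trans (sum-cong-≗ (λ a → trans (*-comm (f a) (δ a y)) (cong (_* f a) (δ-sym a y)))) (∑-δ-* y f)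

  push-δ : ∀ φ a → push φ (δ a) ≗ δ (φ a)
  push-δ φ a y = ∑-δ-* a (λ x → δ (φ x) y)

  push-𝟘 : ∀ φ → push φ 𝟘 ≗ 𝟘
  push-𝟘 φ y = sum-replicate-zero M

  push-⊞ : ∀ φ f g → push φ (f ⊞ g) ≗ push φ f ⊞ push φ g
  push-⊞ φ f g y = trans (sum-cong-≗ (λ a → *-distribʳ-+ (δ (φ a) y) (f a) (g a)))
                         (∑-distrib-+ (λ a → f a * δ (φ a) y) (λ a → g a * δ (φ a) y))

  sum-⋆ : ∀ f g → sum (f ⋆ g) ≡ sum f * sum g
  sum-⋆ f g = begin
    sum (λ s → sum (λ a → f a * g (s -M a)))  ≡⟨ ∑-comm {M} {M} (λ s a → f a * g (s -M a)) ⟩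
    sum (λ a → sum (λ s → f a * g (s -M a)))  ≡⟨ sum-cong-≗ (λ a → *-distribˡ-sum (f a) (λ s → g (s -M a))) ⟨
    sum (λ a → f a * sum (λ s → g (s -M a)))  ≡⟨ sum-cong-≗ (λ a → cong (f a *_) (sum-translate a g)) ⟩
    sum (λ a → f a * sum g)                   ≡⟨ *-distribʳ-sum (sum g) f ⟨
    sum f * sum g                             ∎
    where open ≡-Reasoning

  sum-⋆^ : ∀ f n → sum (f ⋆^ n) ≡ sum f ^ n
  sum-⋆^ f zero    = ∑-δ 0M
  sum-⋆^ f (suc n) = trans (sum-⋆ f (f ⋆^ n)) (cong (sum f *_) (sum-⋆^ f n))

  ⋆-const : ∀ f c s → (f ⋆ const c) s ≡ sum f * c
  ⋆-const f c s = sym (*-distribʳ-sum c f)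

  δ-⋆ : ∀ a b → δ a ⋆ δ b ≗ δ (a +M b)
  δ-⋆ a b s = trans (∑-δ-* a (λ x → δ b (s -M x)))
                    (δ-cong-⇔ (λ b≡s-a → trans (cong (a +M_) b≡s-a) (+M-difference a s))
                              (λ a+b≡s → sym (-M-unique (trans (+M-comm b a) a+b≡s))))

  δ-⋆^ : ∀ a n → δ a ⋆^ n ≗ δ (n ·M a)
  δ-⋆^ a zero    s = refl
  δ-⋆^ a (suc n) s = begin
    (δ a ⋆ δ a ⋆^ n) s        ≡⟨ ⋆-congˡ (δ a) (δ-⋆^ a n) s ⟩
    (δ a ⋆ δ (n ·M a)) s      ≡⟨ δ-⋆ a (n ·M a) s ⟩
    δ (a +M (n ·M a)) s       ≡⟨ cong (λ x → δ x s) (·M-suc n a) ⟨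
    δ (suc n ·M a) s          ∎
    where open ≡-Reasoning

-- The Frobenius congruence

module _ {M : ℕ} .{{_ : NonZero M}} where

  open CommutativeSemiring (convolution-commutativeSemiring {M}) using (semiring)
  open import Algebra.Properties.Semiring.Exp semiring using (^-congˡ) renaming (_^_ to _⋆^_)
  open import Algebra.Properties.Semiring.Mult semiring using () renaming (_×_ to _×⋆_)
  open import Algebra.Properties.Semiring.Sum semiring using () renaming (sum to ∑⋆)
  open import Algebra.Properties.CommutativeSemiring.Binomial (convolution-commutativeSemiring {M})
    using (binomialExpansion; binomial) renaming (theorem to binomial-theorem)

  ×⋆-apply : ∀ n f s → (n ×⋆ f) s ≡ n * f s
  ×⋆-apply zero    f s = refl
  ×⋆-apply (suc n) f s = cong (f s +_) (×⋆-apply n f s)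

  ∑⋆-apply : ∀ {n} (v : Fin n → Fin M → ℕ) s → ∑⋆ v s ≡ sum (λ k → v k s)
  ∑⋆-apply {zero}  v s = refl
  ∑⋆-apply {suc n} v s = cong (v zero s +_) (∑⋆-apply (v ∘ suc) s)

  ∑⋆-δ-decomposition : ∀ f → ∑⋆ (λ a → f a ×⋆ δ a) ≗ f
  ∑⋆-δ-decomposition f s = begin
    ∑⋆ (λ a → f a ×⋆ δ a) s      ≡⟨ ∑⋆-apply (λ a → f a ×⋆ δ a) s ⟩
    sum (λ a → (f a ×⋆ δ a) s)   ≡⟨ sum-cong-≗ (λ a → trans (×⋆-apply (f a) (δ a) s) (*-comm (f a) (δ a s))) ⟩
    sum (λ a → δ a s * f a)      ≡⟨ sum-cong-≗ (λ a → cong (_* f a) (δ-sym a s)) ⟩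
    sum (λ a → δ s a * f a)      ≡⟨ ∑-δ-* s f ⟩
    f s                          ∎
    where open ≡-Reasoning

  𝟘-⋆^ : ∀ n .{{_ : NonZero n}} → 𝟘 ⋆^ n ≗ 𝟘
  𝟘-⋆^ (suc n) = ⋆-zeroˡ (𝟘 ⋆^ n)

  module _ {p : ℕ} .{{_ : NonZero p}} (p-prime : Prime p) where

    freshmans-dream : ∀ f g s → ((f ⊞ g) ⋆^ p) s ≡ (f ⋆^ p) s + (g ⋆^ p) s mod p
    freshmans-dream f g s = begin
      ((f ⊞ g) ⋆^ p) s
        ≡⟨ binomial-theorem p f g s ⟩
      binomialExpansion f g p s
        ≡⟨ ∑⋆-apply (λ k → (p C toℕ k) ×⋆ binomial f g p k) s ⟩
      sum (λ k → ((p C toℕ k) ×⋆ binomial f g p k) s)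
        ≡⟨ sum-cong-≗ (λ k → ×⋆-apply (p C toℕ k) (binomial f g p k) s) ⟩
      sum (λ k → (p C toℕ k) * binomial f g p k s)
        ≈⟨ ∑-binomial-mod-prime p-prime (λ k → binomial f g p k s) ⟩
      binomial f g p zero s + binomial f g p (fromℕ p) s
        ≡⟨ cong₂ _+_ (⋆-identityˡ (g ⋆^ p) s) f^p⋆𝟙 ⟩
      (g ⋆^ p) s + (f ⋆^ p) s
        ≡⟨ +-comm ((g ⋆^ p) s) ((f ⋆^ p) s) ⟩
      (f ⋆^ p) s + (g ⋆^ p) s
        ∎
      where
      open ≡-mod-Reasoning p
      f^p⋆𝟙 : binomial f g p (fromℕ p) s ≡ (f ⋆^ p) s
      f^p⋆𝟙 rewrite toℕ-fromℕ p | n∸n≡0 p = trans (⋆-comm (f ⋆^ p) 𝟙 s) (⋆-identityˡ (f ⋆^ p) s)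

    Frobenius : (Fin M → ℕ) → Set
    Frobenius f = ∀ s → (f ⋆^ p) s ≡ dilate p f s mod p

    frobenius-cong : ∀ {f g} → f ≗ g → Frobenius f → Frobenius g
    frobenius-cong {f} {g} f≗g frob-f s = begin
      (g ⋆^ p) s        ≡⟨ ^-congˡ p f≗g s ⟨
      (f ⋆^ p) s        ≈⟨ frob-f s ⟩
      dilate p f s      ≡⟨ push-congʳ (p ·M_) f≗g s ⟩
      dilate p g s      ∎
      where open ≡-mod-Reasoning p

    frobenius-𝟘 : Frobenius 𝟘
    frobenius-𝟘 s = cong (_% p) (trans (𝟘-⋆^ p s) (sym (push-𝟘 (p ·M_) s)))

    frobenius-δ : ∀ a → Frobenius (δ a)
    frobenius-δ a s = cong (_% p) (trans (δ-⋆^ a p s) (sym (push-δ (p ·M_) a s)))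

    frobenius-⊞ : ∀ {f g} → Frobenius f → Frobenius g → Frobenius (f ⊞ g)
    frobenius-⊞ {f} {g} frob-f frob-g s = begin
      ((f ⊞ g) ⋆^ p) s                ≈⟨ freshmans-dream f g s ⟩
      (f ⋆^ p) s + (g ⋆^ p) s         ≈⟨ +-cong-mod (frob-f s) (frob-g s) ⟩
      dilate p f s + dilate p g s     ≡⟨ push-⊞ (p ·M_) f g s ⟨
      dilate p (f ⊞ g) s              ∎
      where open ≡-mod-Reasoning p

    frobenius-×⋆ : ∀ n {f} → Frobenius f → Frobenius (n ×⋆ f)
    frobenius-×⋆ zero    frob-f = frobenius-𝟘
    frobenius-×⋆ (suc n) frob-f = frobenius-⊞ frob-f (frobenius-×⋆ n frob-f)

    frobenius-∑⋆ : ∀ {n} (v : Fin n → Fin M → ℕ) → (∀ i → Frobenius (v i)) → Frobenius (∑⋆ v)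
    frobenius-∑⋆ {zero}  v frob-v = frobenius-𝟘
    frobenius-∑⋆ {suc n} v frob-v = frobenius-⊞ (frob-v zero) (frobenius-∑⋆ (v ∘ suc) (frob-v ∘ suc))

    frobenius : ∀ f → Frobenius f
    frobenius f = frobenius-cong (∑⋆-δ-decomposition f)
                    (frobenius-∑⋆ _ (λ a → frobenius-×⋆ (f a) (frobenius-δ a)))

-- Tijdeman's theorem

module _ {M : ℕ} .{{_ : NonZero M}} where

  open CommutativeSemiring (convolution-commutativeSemiring {M}) using (semiring)
  open import Algebra.Properties.Semiring.Exp semiring using () renaming (_^_ to _⋆^_)

  ⋆≗1⇒sum*sum≡M : ∀ {h g} → h ⋆ g ≗ const 1 → sum h * sum g ≡ M
  ⋆≗1⇒sum*sum≡M {h} {g} h⋆g≗1 = trans (sym (sum-⋆ h g)) (trans (sum-cong-≗ h⋆g≗1) (∑-const-1 M))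

  dilate-1 : ∀ f → dilate 1 f ≗ f
  dilate-1 f y = trans (push-congˡ f ·M-identityˡ y) (push-id f y)

  dilate-* : ∀ p r f → dilate (p * r) f ≗ dilate p (dilate r f)
  dilate-* p r f y = trans (push-congˡ f (λ a → sym (·M-assoc p r a)) y) (sym (push-∘ (p ·M_) (r ·M_) f y))

  ⋆-congʳ-mod : ∀ m .{{_ : NonZero m}} (g : Fin M → ℕ) {f f′ : Fin M → ℕ} →
                (∀ a → f a ≡ f′ a mod m) → ∀ s → (f ⋆ g) s ≡ (f′ ⋆ g) s mod m
  ⋆-congʳ-mod m g f≡f′ s = sum-cong-mod {m = m} (λ a → *-cong-mod {m} {y = g (s -M a)} (f≡f′ a) refl)

  tijdeman-prime : ∀ {p} → Prime p → ¬ p ∣ M → ∀ {h g} → h ⋆ g ≗ const 1 → dilate p h ⋆ g ≗ const 1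
  tijdeman-prime {suc q} p-prime p∤M {h} {g} h⋆g≗1 s =
    sym (≤-pointwise∧sum≡⇒≗ (λ x → ≡-mod∧∤⇒≥1 (V≡∑h^q x) p∤∑h^q) (trans (∑-const-1 M) (sym ∑V≡M)) s)
    where
    V = dilate (suc q) h ⋆ g
    ∑V≡M : sum V ≡ M
    ∑V≡M = begin
      sum V                                ≡⟨ sum-⋆ (dilate (suc q) h) g ⟩
      sum (dilate (suc q) h) * sum g       ≡⟨ cong (_* sum g) (sum-push (suc q ·M_) h) ⟩
      sum h * sum g                        ≡⟨ ⋆≗1⇒sum*sum≡M h⋆g≗1 ⟩
      M                                    ∎
      where open ≡-Reasoning
    h^p⋆g≗∑h^q : ∀ x → (h ⋆^ suc q ⋆ g) x ≡ sum h ^ q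
    h^p⋆g≗∑h^q x = begin
      (h ⋆ h ⋆^ q ⋆ g) x          ≡⟨ ⋆-congʳ g (⋆-comm h (h ⋆^ q)) x ⟩
      (h ⋆^ q ⋆ h ⋆ g) x          ≡⟨ ⋆-assoc (h ⋆^ q) h g x ⟩
      (h ⋆^ q ⋆ (h ⋆ g)) x        ≡⟨ ⋆-congˡ (h ⋆^ q) h⋆g≗1 x ⟩
      (h ⋆^ q ⋆ const 1) x        ≡⟨ ⋆-const (h ⋆^ q) 1 x ⟩
      sum (h ⋆^ q) * 1            ≡⟨ *-identityʳ _ ⟩
      sum (h ⋆^ q)                ≡⟨ sum-⋆^ h q ⟩
      sum h ^ q                   ∎
      where open ≡-Reasoning
    V≡∑h^q : ∀ x → V x ≡ sum h ^ q mod suc q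
    V≡∑h^q x = begin
      V x                   ≈⟨ ⋆-congʳ-mod (suc q) g {h ⋆^ suc q} {dilate (suc q) h} (frobenius p-prime h) x ⟨
      (h ⋆^ suc q ⋆ g) x    ≡⟨ h^p⋆g≗∑h^q x ⟩
      sum h ^ q             ∎
      where open ≡-mod-Reasoning (suc q)
    p∤∑h^q : ¬ suc q ∣ sum h ^ q
    p∤∑h^q p∣∑h^q = p∤M (subst (suc q ∣_) (⋆≗1⇒sum*sum≡M h⋆g≗1)
                              (∣m⇒∣m*n (sum g) (prime∣^⇒∣ {x = sum h} {q} p-prime p∣∑h^q)))

  tijdeman-primes : ∀ {ps} → All Prime ps → Coprime (product ps) M →
                    ∀ {h g} → h ⋆ g ≗ const 1 → dilate (product ps) h ⋆ g ≗ const 1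
  tijdeman-primes [] _ {h} {g} h⋆g≗1 s = trans (⋆-congʳ g (dilate-1 h) s) (h⋆g≗1 s)
  tijdeman-primes {p ∷ ps} (p-prime ∷ ps-prime) p*N⊥M {h} {g} h⋆g≗1 s =
    trans (⋆-congʳ g (dilate-* p (product ps) h) s)
          (tijdeman-prime p-prime p∤M {dilate (product ps) h} {g} (tijdeman-primes ps-prime N⊥M {h} {g} h⋆g≗1) s)
    where
    N⊥M : Coprime (product ps) M
    N⊥M (e∣N , e∣M) = p*N⊥M (∣n⇒∣m*n p e∣N , e∣M)
    p∤M : ¬ p ∣ M
    p∤M p∣M = prime≢1 p-prime (p*N⊥M (m∣m*n (product ps) , p∣M))

  tijdeman : ∀ {r} → Coprime r M → ∀ {h g} → h ⋆ g ≗ const 1 → dilate r h ⋆ g ≗ const 1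
  -- Coprime 0 M forces M = 1, where all dilations coincide.
  tijdeman {zero} 0⊥M {h} {g} h⋆g≗1 s = trans (⋆-congʳ g dilate-0≗id s) (h⋆g≗1 s)
    where
    Fin-M-trivial : (a b : Fin M) → a ≡ b
    Fin-M-trivial a b = toℕ-injective (trans (toℕ≡0 a) (sym (toℕ≡0 b)))
      where
      toℕ≡0 : (a : Fin M) → toℕ a ≡ 0
      toℕ≡0 a = n<1⇒n≡0 (subst (toℕ a <_) (0-coprimeTo-m⇒m≡1 0⊥M) (toℕ<n a))
    dilate-0≗id : dilate 0 h ≗ h
    dilate-0≗id y = trans (push-congˡ {φ = 0 ·M_} {χ = 1 ·M_} h (λ a → Fin-M-trivial _ _) y) (dilate-1 h y)
  tijdeman {suc r} r⊥M {h} {g} h⋆g≗1 with factorise (suc r)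
  ... | record { factors = ps ; isFactorisation = r≡∏ps ; factorsPrime = ps-prime } =
    subst (λ r → dilate r h ⋆ g ≗ const 1) (sym r≡∏ps)
          (tijdeman-primes ps-prime (subst (λ r → Coprime r M) r≡∏ps r⊥M) {h} {g} h⋆g≗1)

-- Tilings

indicator : ∀ {P : Set} → Dec P → ℕ
indicator (yes _) = 1
indicator (no _)  = 0

indicator-≤1 : ∀ {P : Set} (P? : Dec P) → indicator P? ≤ 1
indicator-≤1 (yes _) = s≤s z≤n
indicator-≤1 (no _)  = z≤n

indicator-yes : ∀ {P : Set} (P? : Dec P) → P → indicator P? ≡ 1
indicator-yes (yes _) _ = refl
indicator-yes (no ¬p) p = contradiction p ¬p

indicator-no : ∀ {P : Set} (P? : Dec P) → ¬ P → indicator P? ≡ 0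
indicator-no (yes p) ¬p = contradiction p ¬p
indicator-no (no _)  _  = refl

indicator-positive : ∀ {P : Set} (P? : Dec P) → 1 ≤ indicator P? → P
indicator-positive (yes p) _ = p

indicator-* : ∀ {P Q : Set} (P? : Dec P) (Q? : Dec Q) → indicator P? * indicator Q? ≡ indicator (P? ×-dec Q?)
indicator-* (yes _) (yes _) = refl
indicator-* (yes _) (no _)  = refl
indicator-* (no _)  _       = refl

module _ {M : ℕ} .{{_ : NonZero M}} where

  UniqueSummands : (Fin M → Fin M) → SubsetM M → SubsetM M → Set
  UniqueSummands φ A B = ∀ {a₁ a₂ b₁ b₂} → A a₁ → A a₂ → B b₁ → B b₂ → φ a₁ +M b₁ ≡ φ a₂ +M b₂ → a₁ ≡ a₂

  module Counting {A B : SubsetM M} (A? : ∀ a → Dec (A a)) (B? : ∀ b → Dec (B b)) where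

    𝟙A 𝟙B : Fin M → ℕ
    𝟙A = indicator ∘ A?
    𝟙B = indicator ∘ B?

    reps : (Fin M → Fin M) → Fin M → Fin M → ℕ
    reps φ s a = indicator (A? a ×-dec B? (s -M φ a))

    reps-yes : ∀ φ {s a b} → A a → B b → φ a +M b ≡ s → reps φ s a ≡ 1
    reps-yes φ {s} {a} {b} Aa Bb φa+b≡s =
      indicator-yes (A? a ×-dec B? (s -M φ a)) (Aa , subst B b≡s-φa Bb)
      where
      b≡s-φa = sym (-M-unique (trans (+M-comm b (φ a)) φa+b≡s))

    reps-no : ∀ φ {s a} → ¬ (A a × B (s -M φ a)) → reps φ s a ≡ 0
    reps-no φ {s} {a} = indicator-no (A? a ×-dec B? (s -M φ a))

    reps-positive : ∀ φ {s a} → 1 ≤ reps φ s a → A a × B (s -M φ a)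
    reps-positive φ {s} {a} = indicator-positive (A? a ×-dec B? (s -M φ a))

    push-⋆-indicator : ∀ φ s → (push φ 𝟙A ⋆ 𝟙B) s ≡ sum (reps φ s)
    push-⋆-indicator φ s = trans (push-⋆ φ 𝟙A 𝟙B s) (sum-cong-≗ (λ a → indicator-* (A? a) (B? (s -M φ a))))

    ⋆≗1⇒unique-summands : ∀ {φ} → push φ 𝟙A ⋆ 𝟙B ≗ const 1 → UniqueSummands φ A B
    ⋆≗1⇒unique-summands {φ} φA⋆B≗1 {a₁} {a₂} {b₁} {b₂} Aa₁ Aa₂ Bb₁ Bb₂ φa₁+b₁≡φa₂+b₂ =
      sum≡1⇒unique (reps φ s) (trans (sym (push-⋆-indicator φ s)) (φA⋆B≗1 s))
        (≤-reflexive (sym (reps-yes φ Aa₁ Bb₁ refl)))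
        (≤-reflexive (sym (reps-yes φ Aa₂ Bb₂ (sym φa₁+b₁≡φa₂+b₂))))
      where
      s = φ a₁ +M b₁

    ⋆≗1⇒tiling : ∀ {φ} → push φ 𝟙A ⋆ 𝟙B ≗ const 1 → Tiling M (image φ A) B
    ⋆≗1⇒tiling {φ} φA⋆B≗1 s = (φ a , s -M φ a) , ((a , Aa , refl) , Bb , +M-difference (φ a) s) , unique
      where
      positive = sum-positive⇒∃ (reps φ s) (≤-reflexive (sym (trans (sym (push-⋆-indicator φ s)) (φA⋆B≗1 s))))
      a = proj₁ positive
      Aa = proj₁ (reps-positive φ (proj₂ positive))
      Bb = proj₂ (reps-positive φ (proj₂ positive))
      unique : ∀ {y} → (let (c , b) = y in image φ A c × B b × c +M b ≡ s) → (φ a , s -M φ a) ≡ y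
      unique {_ , b′} ((a′ , Aa′ , refl) , Bb′ , φa′+b′≡s) = cong₂ _,_ (cong φ a≡a′) (-M-unique b′+φa≡s)
        where
        a≡a′ = ⋆≗1⇒unique-summands φA⋆B≗1 Aa Aa′ Bb Bb′ (trans (+M-difference (φ a) s) (sym φa′+b′≡s))
        b′+φa≡s = trans (+M-comm b′ (φ a)) (trans (cong (λ x → φ x +M b′) a≡a′) φa′+b′≡s)

    unique-summands⇒⋆≗1 : ∀ {φ} → UniqueSummands φ A B → sum 𝟙A * sum 𝟙B ≡ M → push φ 𝟙A ⋆ 𝟙B ≗ const 1
    unique-summands⇒⋆≗1 {φ} unique |A||B|≡M = ≤-pointwise∧sum≡⇒≗ W≤1 (begin
      sum W                       ≡⟨ sum-⋆ (push φ 𝟙A) 𝟙B ⟩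
      sum (push φ 𝟙A) * sum 𝟙B    ≡⟨ cong (_* sum 𝟙B) (sum-push φ 𝟙A) ⟩
      sum 𝟙A * sum 𝟙B             ≡⟨ |A||B|≡M ⟩
      M                           ≡⟨ ∑-const-1 M ⟨
      sum {M} (const 1)           ∎)
      where
      open ≡-Reasoning
      W = push φ 𝟙A ⋆ 𝟙B
      W≤1 : ∀ s → W s ≤ 1
      W≤1 s = subst (_≤ 1) (sym (push-⋆-indicator φ s))
        (sum-≤1 (reps φ s) (λ a → indicator-≤1 (A? a ×-dec B? (s -M φ a))) reps-unique)
        where
        reps-unique : ∀ a₁ a₂ → 1 ≤ reps φ s a₁ → 1 ≤ reps φ s a₂ → a₁ ≡ a₂
        reps-unique a₁ a₂ t₁ t₂ with reps-positive φ t₁ | reps-positive φ t₂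
        ... | Aa₁ , Bb₁ | Aa₂ , Bb₂ =
          unique Aa₁ Aa₂ Bb₁ Bb₂ (trans (+M-difference (φ a₁) s) (sym (+M-difference (φ a₂) s)))

module _ {M : ℕ} .{{_ : NonZero M}} {A B : SubsetM M} (tiling : Tiling M A B) where

  -- With b₀ ∈ B fixed, a ∈ A iff a + b₀ decomposes as (a , b₀).
  tiling-decidableˡ : ∀ a → Dec (A a)
  tiling-decidableˡ a with tiling 0M
  ... | (_ , b₀) , (_ , Bb₀ , _) , _ with tiling (a +M b₀)
  ...   | (a′ , _) , (Aa′ , _) , unique with a′ ≟ a
  ...     | yes refl = yes Aa′
  ...     | no a′≢a  = no λ Aa → a′≢a (cong proj₁ (unique (Aa , Bb₀ , refl)))

  tiling-decidableʳ : ∀ b → Dec (B b)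
  tiling-decidableʳ b with tiling 0M
  ... | (a₀ , _) , (Aa₀ , _ , _) , _ with tiling (a₀ +M b)
  ...   | (_ , b′) , (_ , Bb′ , _) , unique with b′ ≟ b
  ...     | yes refl = yes Bb′
  ...     | no b′≢b  = no λ Bb → b′≢b (cong proj₂ (unique (Aa₀ , Bb , refl)))

  open Counting tiling-decidableˡ tiling-decidableʳ

  tiling⇒⋆≗1 : 𝟙A ⋆ 𝟙B ≗ const 1
  tiling⇒⋆≗1 s with tiling s
  ... | (a* , b*) , (Aa* , Bb* , a*+b*≡s) , unique = begin
    sum (λ a → 𝟙A a * 𝟙B (s -M a))
      ≡⟨ sum-cong-≗ (λ a → indicator-* (tiling-decidableˡ a) (tiling-decidableʳ (s -M a))) ⟩
    sum (reps (λ a → a) s)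
      ≡⟨ sum-cong-≗ reps≡δ ⟩
    sum (δ a*)
      ≡⟨ ∑-δ a* ⟩
    1
      ∎
    where
    open ≡-Reasoning
    reps≡δ : ∀ a → reps (λ a → a) s a ≡ δ a* a
    reps≡δ a with a* ≟ a
    ... | yes refl = trans (reps-yes (λ a → a) Aa* Bb* a*+b*≡s) (sym (δ-diag a*))
    ... | no a*≢a  = trans (reps-no (λ a → a) λ (Aa , Bb) → a*≢a (cong proj₁ (unique (Aa , Bb , +M-difference a s))))
                           (sym (δ-≢ a*≢a))

  isometry⇒unique-summands : ∀ {ψ} → DivisorIsometry M ψ → UniqueSummands ψ A B
  isometry⇒unique-summands {ψ} isometry {a₁} {a₂} {b₁} {b₂} Aa₁ Aa₂ Bb₁ Bb₂ ψa₁+b₁≡ψa₂+b₂ =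
    ⋆≗1⇒unique-summands {r ·M_} (tijdeman r⊥M {𝟙A} {𝟙B} tiling⇒⋆≗1) Aa₁ Aa₂ Bb₁ Bb₂ (·M-transfer r r*Δa≡Δb)
    where
    gcd-Δa≡gcd-Δψa : gcd (toℕ (a₁ -M a₂)) M ≡ gcd (toℕ (ψ a₁ -M ψ a₂)) M
    gcd-Δa≡gcd-Δψa = begin
      gcd (toℕ (a₁ -M a₂)) M        ≡⟨ cong (λ x → gcd x M) (toℕ--M≡diffM a₁ a₂) ⟩
      gcd (diffM a₁ a₂) M           ≡⟨ isometry a₁ a₂ ⟨
      gcd (diffM (ψ a₁) (ψ a₂)) M   ≡⟨ cong (λ x → gcd x M) (toℕ--M≡diffM (ψ a₁) (ψ a₂)) ⟨
      gcd (toℕ (ψ a₁ -M ψ a₂)) M    ∎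
      where open ≡-Reasoning
    multiplier = gcd≡⇒coprime-multiplier (toℕ (a₁ -M a₂)) (toℕ (ψ a₁ -M ψ a₂)) gcd-Δa≡gcd-Δψa
    r = proj₁ multiplier
    r⊥M = proj₁ (proj₂ multiplier)
    r*Δa≡Δb : r * toℕ (a₁ -M a₂) ≡ toℕ (b₂ -M b₁) mod M
    r*Δa≡Δb = begin
      r * toℕ (a₁ -M a₂)         ≈⟨ proj₂ (proj₂ multiplier) ⟩
      toℕ (ψ a₁ -M ψ a₂)         ≡⟨ cong toℕ (-M-swap {c₁ = ψ a₁} {ψ a₂} ψa₁+b₁≡ψa₂+b₂) ⟩
      toℕ (b₂ -M b₁)             ∎
      where open ≡-mod-Reasoning M

lemma3p4 : (M : ℕ) .{{_ : NonZero M}} (ψ : Fin M → Fin M) (A B : SubsetM M) →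
           DivisorIsometry M ψ → Tiling M A B → Tiling M (image ψ A) B
lemma3p4 M ψ A B isometry tiling = ⋆≗1⇒tiling ψA⋆B≗1
  where
  open Counting (tiling-decidableˡ tiling) (tiling-decidableʳ tiling)
  |A||B|≡M : sum 𝟙A * sum 𝟙B ≡ M
  |A||B|≡M = ⋆≗1⇒sum*sum≡M (tiling⇒⋆≗1 tiling)
  ψA⋆B≗1 : push ψ 𝟙A ⋆ 𝟙B ≗ const 1
  ψA⋆B≗1 = unique-summands⇒⋆≗1 (isometry⇒unique-summands tiling {ψ} isometry) |A||B|≡M
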